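{- Let $G=(G'_\ell,A'_\ell,B'_\ell)\circ(G'_{\ell-1},A'_{\ell-1},B'_{\ell-1})\circ\cdots\circ(G'_1,A'_1,B'_1)\circ G'_0$ be the compact canonical decomposition of $G$. Then $\mathrm{Aut}(G)$ is isomorphic to $\mathrm{Aut}(G'_\ell)\times\mathrm{Aut}(G'_{\ell-1})\times\cdots\times\mathrm{Aut}(G'_1)\times\mathrm{Aut}(G'_0)$.
   Context: All graphs are finite and simple; $\mathrm{Aut}(G)$ is the automorphism group of $G$. A graph $G$ is split if $V(G)$ can be partitioned into sets $A,B$ (either possibly empty) with $A$ a clique and $B$ an independent set; $(A,B)$ is a $KS$-partition and $(G,A,B)$ the split graph with this partition. For a split graph $(G,A,B)$ and a graph $H$ with disjoint vertex sets, $(G,A,B)\circ H$ has vertex set $V(G)\cup V(H)$ and edge set $E(G)\cup E(H)\cup\{uv:u\in A,v\in V(H)\}$; if $H=(H,A',B')$ is split the result is regarded as split with $KS$-partition $(A\cup A',B\cup B')$. Composition is associative. A graph is decomposable if it is isomorphic to $(G,A,B)\circ H$ for a split graph $(G,A,B)$ and a graph $H$ each with at least one vertex; otherwise indecomposable. (Tyshkevich) Every graph $G$ has a canonical decomposition $G=(G_k,A_k,B_k)\circ\cdots\circ(G_1,A_1,B_1)\circ G_0$ with every $G_i$ indecomposable, unique up to isomorphism of the components. A single-vertex component $(G_i,A_i,B_i)$, $i\ge1$, has type $K_1$ if its vertex lies in $A_i$ and type $S_1$ if it lies in $B_i$; if $G_0$ and $G_1$ both have a single vertex, $G_0$ is assigned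 the type of $G_1$. The compact canonical decomposition is obtained from the canonical decomposition by replacing each maximal run of consecutive single-vertex components of the same type, say $m$ of them, by one component: the complete graph on those $m$ vertices with $KS$-partition (all vertices, $\emptyset$) for type $K_1$, or the edgeless graph on those $m$ vertices with $KS$-partition ($\emptyset$, all vertices) for type $S_1$. It is unique up to isomorphism, and each component is an indecomposable graph with at least two vertices, a complete graph, or an edgeless graph. -}

module Defs where

open import Data.Nat using (ℕ; zero; suc; _+_; _≤_)
open import Data.Fin using (Fin; splitAt)
open import Data.Bool using (Bool; true; false; not)
open import Data.Sum using (_⊎_; inj₁; inj₂)
open import Data.Product using (Σ; Σ-syntax; _×_; _,_; proj₁; proj₂)
open import Data.List using (List; []; _∷_; map)
open import Data.Maybe using (Maybe; just; nothing)
open import Relation.Nullary using (¬_)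
open import Relation.Binary.PropositionalEquality
  using (_≡_; _≢_; refl; sym; trans; cong; cong₂)
open import Relation.Nullary using (yes; no)
open import Data.Empty using (⊥-elim)
open import Data.Bool using (if_then_else_)
open import Level using (0ℓ)
import Data.Fin as Fin
open import Algebra.Morphism.Structures using (module GroupMorphisms)
open GroupMorphisms using (IsGroupIsomorphism)
open import Algebra.Bundles using (Group)
import Algebra.Construct.DirectProduct as DP
import Algebra.Construct.Terminal as Terminal

record Graph : Set where
  field
    n     : ℕ
    adj   : Fin n → Fin n → Bool
    adj-sym : ∀ i j → adj i j ≡ adj j i
    irrefl : ∀ i → adj i i ≡ false
open Graph public

record Iso (G H : Graph) : Set where
  field
    to      : Fin (n G) → Fin (n H)
    from    : Fin (n H) → Fin (n G)
    from-to : ∀ x → from (to x) ≡ x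
    to-from : ∀ y → to (from y) ≡ y
    adj-pres : ∀ i j → adj H (to i) (to j) ≡ adj G i j
open Iso public

-- Split graphs (G, A, B): inA i = true iff i ∈ A, otherwise i ∈ B.

record SplitGraph : Set where
  field
    graph  : Graph
    inA    : Fin (n graph) → Bool
    clique : ∀ i j → i ≢ j → inA i ≡ true → inA j ≡ true →
             adj graph i j ≡ true
    indep  : ∀ i j → inA i ≡ false → inA j ≡ false →
             adj graph i j ≡ false
open SplitGraph public

-- Composition (G, A, B) ∘ H on vertex set Fin (n G + n H)
-- (first n G vertices are those of G, the rest those of H).

module _ (S : SplitGraph) (H : Graph) where
  private
    G = graph S
    adj⊎ : Fin (n G) ⊎ Fin (n H) → Fin (n G) ⊎ Fin (n H) → Bool
    adj⊎ (inj₁ i) (inj₁ j) = adj G i j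
    adj⊎ (inj₂ i) (inj₂ j) = adj H i j
    adj⊎ (inj₁ i) (inj₂ _) = inA S i
    adj⊎ (inj₂ _) (inj₁ j) = inA S j

    adj⊎-sym : ∀ u v → adj⊎ u v ≡ adj⊎ v u
    adj⊎-sym (inj₁ i) (inj₁ j) = adj-sym G i j
    adj⊎-sym (inj₂ i) (inj₂ j) = adj-sym H i j
    adj⊎-sym (inj₁ i) (inj₂ _) = refl
    adj⊎-sym (inj₂ _) (inj₁ j) = refl

    adj⊎-irr : ∀ u → adj⊎ u u ≡ false
    adj⊎-irr (inj₁ i) = irrefl G i
    adj⊎-irr (inj₂ i) = irrefl H i

  infixr 5 _∘G_
  _∘G_ : Graph
  _∘G_ = record
    { n      = n G + n H
    ; adj    = λ x y → adj⊎ (splitAt (n G) x) (splitAt (n G) y)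
    ; adj-sym = λ x y → adj⊎-sym (splitAt (n G) x) (splitAt (n G) y)
    ; irrefl = λ x → adj⊎-irr (splitAt (n G) x)
    }

Decomposable : Graph → Set
Decomposable X =
  Σ[ S ∈ SplitGraph ] Σ[ H ∈ Graph ]
    (1 ≤ n (graph S)) × (1 ≤ n H) × Iso X (S ∘G H)

Indecomposable : Graph → Set
Indecomposable X = ¬ Decomposable X

-- Decompositions are stored INNERMOST FIRST:  the list
--   G₁ ∷ G₂ ∷ … ∷ Gₖ ∷ []   together with G₀  represents
--   Gₖ ∘ ( … ∘ (G₁ ∘ G₀)).

composeAll : Graph → List SplitGraph → Graph
composeAll G₀ []       = G₀
composeAll G₀ (S ∷ Ss) = composeAll (S ∘G G₀) Ss

data All {A : Set} (P : A → Set) : List A → Set where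
  []  : All P []
  _∷_ : ∀ {x xs} → P x → All P xs → All P (x ∷ xs)

record CanonicalDecomposition (G : Graph) : Set where
  field
    G₀        : Graph
    comps     : List SplitGraph
    G₀-nonempty    : 1 ≤ n G₀
    comps-nonempty : All (λ S → 1 ≤ n (graph S)) comps
    G₀-indec       : Indecomposable G₀
    comps-indec    : All (λ S → Indecomposable (graph S)) comps
    iso            : Iso G (composeAll G₀ comps)
open CanonicalDecomposition public

data SType : Set where
  K₁ S₁ : SType

_==ᵗ_ : SType → SType → Bool
K₁ ==ᵗ K₁ = true
S₁ ==ᵗ S₁ = true
_  ==ᵗ _  = false

completeSplit : ℕ → SplitGraph
completeSplit m = record
  { graph = record { n = m ; adj = cadj ; adj-sym = csym ; irrefl = cirr }
  ; inA = λ _ → true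
  ; clique = λ i j i≢j _ _ → cne i j i≢j
  ; indep = λ _ _ ()
  }
  where
  cadj : Fin m → Fin m → Bool
  cadj i j with i Fin.≟ j
  ... | yes _ = false
  ... | no _  = true
  csym : ∀ i j → cadj i j ≡ cadj j i
  csym i j with i Fin.≟ j | j Fin.≟ i
  ... | yes _ | yes _ = refl
  ... | no _  | no _  = refl
  ... | yes p | no ¬q = ⊥-elim (¬q (sym p))
  ... | no ¬p | yes q = ⊥-elim (¬p (sym q))
  cirr : ∀ i → cadj i i ≡ false
  cirr i with i Fin.≟ i
  ... | yes _ = refl
  ... | no ¬p = ⊥-elim (¬p refl)
  cne : ∀ i j → i ≢ j → cadj i j ≡ true
  cne i j i≢j with i Fin.≟ j
  ... | yes p = ⊥-elim (i≢j p)
  ... | no _  = refl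

edgelessSplit : ℕ → SplitGraph
edgelessSplit m = record
  { graph = record { n = m ; adj = λ _ _ → false
                   ; adj-sym = λ _ _ → refl ; irrefl = λ _ → refl }
  ; inA = λ _ → false
  ; clique = λ _ _ _ ()
  ; indep = λ _ _ _ _ → refl
  }

runComponent : SType → ℕ → SplitGraph
runComponent K₁ m = completeSplit m
runComponent S₁ m = edgelessSplit m

-- A component of the canonical decomposition (i ≥ 1) is either a
-- single vertex of type K₁ / S₁, or a component with ≥ 2 vertices
-- (or, degenerately, 0 vertices -- excluded by the hypotheses).
Item : Set
Item = SType ⊎ SplitGraph

classify : SplitGraph → Item
classify S with n (graph S) | inA S
... | suc zero | a = inj₁ (if a Fin.zero then K₁ else S₁)
... | _        | _ = inj₂ S

-- merge maximal runs of equal-type single vertices; the Maybe holds the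
-- current run (type, number of vertices so far).
mergeRuns : Maybe (SType × ℕ) → List Item → List SplitGraph
mergeRuns nothing        []             = []
mergeRuns (just (t , m)) []             = runComponent t m ∷ []
mergeRuns nothing        (inj₂ S ∷ xs)  = S ∷ mergeRuns nothing xs
mergeRuns (just (t , m)) (inj₂ S ∷ xs)  =
  runComponent t m ∷ S ∷ mergeRuns nothing xs
mergeRuns nothing        (inj₁ t ∷ xs)  = mergeRuns (just (t , 1)) xs
mergeRuns (just (t , m)) (inj₁ t′ ∷ xs) =
  if t ==ᵗ t′ then mergeRuns (just (t , suc m)) xs
              else runComponent t m ∷ mergeRuns (just (t′ , 1)) xs

takeRun : SType → List Item → ℕ × List Item
takeRun t []              = 0 , []
takeRun t (inj₂ S ∷ xs)   = 0 , inj₂ S ∷ xs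
takeRun t (inj₁ t′ ∷ xs) with t ==ᵗ t′
... | true  = let (c , r) = takeRun t xs in suc c , r
... | false = 0 , inj₁ t′ ∷ xs

record CompactDecomposition : Set where
  field
    G₀′    : Graph
    comps′ : List SplitGraph
open CompactDecomposition public

-- If G₀ and G₁ both have one vertex, G₀ gets the type t of G₁ and the
-- run of type t starting at G₀ becomes G′₀ (K_m or edgeless on m).
compactFrom : Graph → List SplitGraph → CompactDecomposition
compactFrom G₀ Ss with n G₀ | map classify Ss
... | suc zero | inj₁ t ∷ xs =
  let (c , rest) = takeRun t xs
  in record { G₀′ = graph (runComponent t (suc (suc c)))
            ; comps′ = mergeRuns nothing rest }
... | _ | items = record { G₀′ = G₀ ; comps′ = mergeRuns nothing items }

compact : ∀ {G} → CanonicalDecomposition G → CompactDecomposition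
compact D = compactFrom (G₀ D) (comps D)

Aut : Graph → Set
Aut G = Iso G G

module _ (G : Graph) where
  _≈ᴬ_ : Aut G → Aut G → Set
  σ ≈ᴬ τ = ∀ x → to σ x ≡ to τ x

  _·ᴬ_ : Aut G → Aut G → Aut G
  σ ·ᴬ τ = record
    { to = λ x → to σ (to τ x)
    ; from = λ y → from τ (from σ y)
    ; from-to = λ x → trans (cong (from τ) (from-to σ (to τ x))) (from-to τ x)
    ; to-from = λ y → trans (cong (to σ) (to-from τ (from σ y))) (to-from σ y)
    ; adj-pres = λ i j → trans (adj-pres σ (to τ i) (to τ j)) (adj-pres τ i j)
    }

  idᴬ : Aut G
  idᴬ = record { to = λ x → x ; from = λ x → x ; from-to = λ _ → refl
               ; to-from = λ _ → refl ; adj-pres = λ _ _ → refl }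

  invᴬ : Aut G → Aut G
  invᴬ σ = record
    { to = from σ ; from = to σ ; from-to = to-from σ ; to-from = from-to σ
    ; adj-pres = λ i j → trans (sym (adj-pres σ (from σ i) (from σ j)))
                               (cong₂ (adj G) (to-from σ i) (to-from σ j))
    }

  AutGroup : Group 0ℓ 0ℓ
  AutGroup = record
    { Carrier = Aut G
    ; _≈_ = _≈ᴬ_
    ; _∙_ = _·ᴬ_
    ; ε = idᴬ
    ; _⁻¹ = invᴬ
    ; isGroup = record
      { isMonoid = record
        { isSemigroup = record
          { isMagma = record
            { isEquivalence = record
              { refl = λ _ → refl
              ; sym = λ p x → sym (p x)
              ; trans = λ p q x → trans (p x) (q x) }
            ; ∙-cong = λ {σ} {σ′} {τ} {τ′} p q x →
                trans (cong (to σ) (q x)) (p (to τ′ x)) }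
          ; assoc = λ _ _ _ _ → refl }
        ; identity = (λ _ _ → refl) , (λ _ _ → refl) }
      ; inverse = (λ σ x → from-to σ x) , (λ σ y → to-from σ y)
      ; ⁻¹-cong = λ {σ} {σ′} p y →
          trans (cong (from σ) (sym (to-from σ′ y)))
         (trans (cong (from σ) (sym (p (from σ′ y))))
                (from-to σ (from σ′ y)))
      }
    }

AutProduct : List Graph → Group 0ℓ 0ℓ
AutProduct []       = Terminal.group
AutProduct (H ∷ Hs) = DP.group (AutGroup H) (AutProduct Hs)

componentGraphs : CompactDecomposition → List Graph
componentGraphs C = G₀′ C ∷ map graph (comps′ C)

_≅ᴳ_ : Group 0ℓ 0ℓ → Group 0ℓ 0ℓ → Set
G₁ ≅ᴳ G₂ = Σ[ φ ∈ (Group.Carrier G₁ → Group.Carrier G₂) ]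
  IsGroupIsomorphism (Group.rawGroup G₁) (Group.rawGroup G₂) φ

{-# OPTIONS --safe #-}

-- An automorphism σ of a composition S ∘ H maps the vertices of S onto themselves in two
-- situations. If S is indecomposable with at least two vertices, the vertices of S that σ sends
-- into H would split S as a composition (and if σ sent all of S into H, some a ∈ A and b ∈ B
-- would be both adjacent and non-adjacent). If S is complete (edgeless) and H has no universal
-- (isolated) vertex, the vertices of S are exactly the universal (isolated) vertices of S ∘ H.
-- Automorphisms of S preserve A in both cases (an indecomposable split graph has a unique
-- KS-partition), so Aut(S ∘ H) ≅ Aut(S) × Aut(H). Each component of the compact canonical
-- decomposition is in one of these situations relative to the composition below it, since
-- consecutive runs of single vertices have different types; induction gives the product.

module Submission where

open import Defs

open import Level using (0ℓ)
open import Algebra.Bundles using (Group)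
import Algebra.Construct.DirectProduct as DP
import Algebra.Construct.Terminal as Terminal
import Algebra.Properties.Group as GroupProperties
open import Data.Bool using (Bool; true; false; not; if_then_else_)
open import Data.Bool.Properties using (¬-not; not-¬)
import Data.Bool.Properties as Bool
open import Data.Empty using (⊥-elim)
open import Data.Fin using (Fin; zero; suc; splitAt; join; _↑ˡ_; _↑ʳ_; _≟_; fromℕ<)
open import Data.Fin.Properties
  using ( splitAt-↑ˡ; splitAt-↑ʳ; splitAt⁻¹-↑ˡ; splitAt⁻¹-↑ʳ; splitAt-join; join-splitAt
        ; ↑ˡ-injective; ↑ʳ-injective; any?; all?; ¬∀⟶∃¬)
open import Data.List using (List; []; _∷_; map)
open import Data.Maybe using (Maybe; just; nothing)
open import Data.Nat using (ℕ; zero; suc; _+_; _≤_; s≤s; z≤n)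
open import Data.Nat.Properties using (≤-trans; m≤m+n; m≤n⇒m≤1+n; +-identityʳ; +-suc)
open import Data.Unit using (⊤; tt)
open import Data.Product using (∃; _×_; _,_; proj₁; proj₂)
open import Data.Sum using (_⊎_; inj₁; inj₂; fromInj₁; [_,_]′)
import Data.Sum as Sum
import Data.Sum.Properties as Sum
open import Function using (_∘_; id; const)
open import Relation.Nullary using (¬_; contradiction; yes; no; ¬?)
open import Relation.Nullary.Decidable using (decidable-stable; _→-dec_)
open import Relation.Unary using (Decidable)
open import Relation.Binary.PropositionalEquality

record _≃ᴳ_ (G H : Group 0ℓ 0ℓ) : Set where
  private
    module G = Group G
    module H = Group H
  field
    to        : G.Carrier → H.Carrier
    from      : H.Carrier → G.Carrier
    to-cong   : ∀ {x y} → x G.≈ y → to x H.≈ to y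
    from-cong : ∀ {x y} → x H.≈ y → from x G.≈ from y
    to-homo   : ∀ x y → to (x G.∙ y) H.≈ to x H.∙ to y
    from-to   : ∀ x → from (to x) G.≈ x
    to-from   : ∀ y → to (from y) H.≈ y
open _≃ᴳ_

infixr 2 _×ᴳ_
_×ᴳ_ : Group 0ℓ 0ℓ → Group 0ℓ 0ℓ → Group 0ℓ 0ℓ
_×ᴳ_ = DP.group

module _ {G H : Group 0ℓ 0ℓ} (φ : G ≃ᴳ H) where
  private
    module G = Group G
    module H = Group H
    open GroupProperties H using (identityˡ-unique; inverseˡ-unique)

  to-ε : to φ G.ε H.≈ H.ε
  to-ε = identityˡ-unique (to φ G.ε) (to φ G.ε)
    (H.trans (H.sym (to-homo φ G.ε G.ε)) (to-cong φ (G.identityˡ G.ε)))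

  to-⁻¹ : ∀ x → to φ (x G.⁻¹) H.≈ to φ x H.⁻¹
  to-⁻¹ x = inverseˡ-unique (to φ (x G.⁻¹)) (to φ x)
    (H.trans (H.sym (to-homo φ (x G.⁻¹) x)) (H.trans (to-cong φ (G.inverseˡ x)) to-ε))

  ≃ᴳ⇒≅ᴳ : G ≅ᴳ H
  ≃ᴳ⇒≅ᴳ = to φ , record
    { isGroupMonomorphism = record
      { isGroupHomomorphism = record
        { isMonoidHomomorphism = record
          { isMagmaHomomorphism = record
            { isRelHomomorphism = record { cong = to-cong φ }
            ; homo = to-homo φ }
          ; ε-homo = to-ε }
        ; ⁻¹-homo = to-⁻¹ }
      ; injective = λ {x} {y} tx≈ty →
          G.trans (G.sym (from-to φ x)) (G.trans (from-cong φ tx≈ty) (from-to φ y)) }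
    ; surjective = λ y → from φ y , λ z≈ → H.trans (to-cong φ z≈) (to-from φ y) }

≃ᴳ-refl : ∀ {G} → G ≃ᴳ G
≃ᴳ-refl {G} = record
  { to = id ; from = id ; to-cong = id ; from-cong = id
  ; to-homo = λ _ _ → G.refl ; from-to = λ _ → G.refl ; to-from = λ _ → G.refl }
  where module G = Group G

≃ᴳ-trans : ∀ {G H K} → G ≃ᴳ H → H ≃ᴳ K → G ≃ᴳ K
≃ᴳ-trans {G} {H} {K} φ ψ = record
  { to = to ψ ∘ to φ
  ; from = from φ ∘ from ψ
  ; to-cong = to-cong ψ ∘ to-cong φ
  ; from-cong = from-cong φ ∘ from-cong ψ
  ; to-homo = λ x y → K.trans (to-cong ψ (to-homo φ x y)) (to-homo ψ _ _)
  ; from-to = λ x → G.trans (from-cong φ (from-to ψ _)) (from-to φ x)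
  ; to-from = λ z → K.trans (to-cong ψ (to-from φ _)) (to-from ψ z) }
  where
  module G = Group G
  module K = Group K

×-cong : ∀ {G G′ H H′} → G ≃ᴳ G′ → H ≃ᴳ H′ → (G ×ᴳ H) ≃ᴳ (G′ ×ᴳ H′)
×-cong φ ψ = record
  { to = λ (x , y) → to φ x , to ψ y
  ; from = λ (x , y) → from φ x , from ψ y
  ; to-cong = λ (x≈ , y≈) → to-cong φ x≈ , to-cong ψ y≈
  ; from-cong = λ (x≈ , y≈) → from-cong φ x≈ , from-cong ψ y≈
  ; to-homo = λ _ _ → to-homo φ _ _ , to-homo ψ _ _
  ; from-to = λ _ → from-to φ _ , from-to ψ _
  ; to-from = λ _ → to-from φ _ , to-from ψ _ }

×-assoc : ∀ {G H K} → ((G ×ᴳ H) ×ᴳ K) ≃ᴳ (G ×ᴳ (H ×ᴳ K))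
×-assoc {G} {H} {K} = record
  { to = λ ((x , y) , z) → x , (y , z)
  ; from = λ (x , (y , z)) → (x , y) , z
  ; to-cong = λ ((x≈ , y≈) , z≈) → x≈ , (y≈ , z≈)
  ; from-cong = λ (x≈ , (y≈ , z≈)) → (x≈ , y≈) , z≈
  ; to-homo = λ _ _ → G.refl , (H.refl , K.refl)
  ; from-to = λ _ → (G.refl , H.refl) , K.refl
  ; to-from = λ _ → G.refl , (H.refl , K.refl) }
  where
  module G = Group G
  module H = Group H
  module K = Group K

×-comm : ∀ {G H} → (G ×ᴳ H) ≃ᴳ (H ×ᴳ G)
×-comm {G} {H} = record
  { to = λ (x , y) → y , x
  ; from = λ (y , x) → x , y
  ; to-cong = λ (x≈ , y≈) → y≈ , x≈
  ; from-cong = λ (y≈ , x≈) → x≈ , y≈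
  ; to-homo = λ _ _ → H.refl , G.refl
  ; from-to = λ _ → G.refl , H.refl
  ; to-from = λ _ → H.refl , G.refl }
  where
  module G = Group G
  module H = Group H

×-identityʳ : ∀ {G} → G ≃ᴳ (G ×ᴳ Terminal.group)
×-identityʳ {G} = record
  { to = λ x → x , _
  ; from = proj₁
  ; to-cong = λ x≈ → x≈ , _
  ; from-cong = proj₁
  ; to-homo = λ _ _ → G.refl , _
  ; from-to = λ _ → G.refl
  ; to-from = λ _ → G.refl , _ }
  where module G = Group G

Iso-refl : ∀ {G} → Iso G G
Iso-refl {G} = idᴬ G

Iso-sym : ∀ {G H} → Iso G H → Iso H G
Iso-sym {G} {H} φ = record
  { to = from φ
  ; from = to φ
  ; from-to = to-from φ
  ; to-from = from-to φ
  ; adj-pres = λ i j → trans (sym (adj-pres φ (from φ i) (from φ j)))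
                             (cong₂ (adj H) (to-from φ i) (to-from φ j)) }

Iso-trans : ∀ {G H K} → Iso G H → Iso H K → Iso G K
Iso-trans φ ψ = record
  { to = to ψ ∘ to φ
  ; from = from φ ∘ from ψ
  ; from-to = λ x → trans (cong (from φ) (from-to ψ (to φ x))) (from-to φ x)
  ; to-from = λ z → trans (cong (to ψ) (to-from φ (from ψ z))) (to-from ψ z)
  ; adj-pres = λ i j → trans (adj-pres ψ (to φ i) (to φ j)) (adj-pres φ i j) }

Iso-to-injective : ∀ {X Y} (φ : Iso X Y) {x y} → to φ x ≡ to φ y → x ≡ y
Iso-to-injective φ {x} {y} eq = trans (sym (from-to φ x)) (trans (cong (from φ) eq) (from-to φ y))

Iso-order1 : ∀ {X Y} → n X ≡ 1 → n Y ≡ 1 → Iso X Y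
Iso-order1 {record { irrefl = irreflX }} {record { irrefl = irreflY }} refl refl = record
  { to = id ; from = id ; from-to = λ _ → refl ; to-from = λ _ → refl
  ; adj-pres = λ { zero zero → trans (irreflY zero) (sym (irreflX zero)) } }

Aut-cong : ∀ {G H} → Iso G H → AutGroup G ≃ᴳ AutGroup H
Aut-cong φ = record
  { to = λ σ → Iso-trans (Iso-sym φ) (Iso-trans σ φ)
  ; from = λ τ → Iso-trans φ (Iso-trans τ (Iso-sym φ))
  ; to-cong = λ σ≈σ′ y → cong (to φ) (σ≈σ′ (from φ y))
  ; from-cong = λ τ≈τ′ x → cong (from φ) (τ≈τ′ (to φ x))
  ; to-homo = λ σ τ y → cong (to φ ∘ to σ) (sym (from-to φ (to τ (from φ y))))
  ; from-to = λ σ x → trans (from-to φ _) (cong (to σ) (from-to φ x))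
  ; to-from = λ τ y → trans (to-from φ _) (cong (to τ) (to-from φ y)) }

module _ {m k : ℕ} where

  ↑ˡ≢↑ʳ : ∀ {i : Fin m} {h : Fin k} → i ↑ˡ k ≢ m ↑ʳ h
  ↑ˡ≢↑ʳ {i} {h} eq
    with () ← trans (sym (splitAt-↑ˡ m i k)) (trans (cong (splitAt m) eq) (splitAt-↑ʳ m k h))

  ↑-view : ∀ w → (∃ λ i → w ≡ i ↑ˡ k) ⊎ (∃ λ h → w ≡ m ↑ʳ h)
  ↑-view w with splitAt m w in eq
  ... | inj₁ i = inj₁ (i , sym (splitAt⁻¹-↑ˡ eq))
  ... | inj₂ h = inj₂ (h , sym (splitAt⁻¹-↑ʳ eq))

module _ {m m′ k k′ : ℕ} where

  map↑ : (Fin m → Fin m′) → (Fin k → Fin k′) → Fin (m + k) → Fin (m′ + k′)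
  map↑ f g = join m′ k′ ∘ Sum.map f g ∘ splitAt m

  map↑-↑ˡ : ∀ f g i → map↑ f g (i ↑ˡ k) ≡ f i ↑ˡ k′
  map↑-↑ˡ f g i rewrite splitAt-↑ˡ m i k = refl

  map↑-↑ʳ : ∀ f g h → map↑ f g (m ↑ʳ h) ≡ m′ ↑ʳ g h
  map↑-↑ʳ f g h rewrite splitAt-↑ʳ m k h = refl

map↑-cong : ∀ {m m′ k k′} {f f′ : Fin m → Fin m′} {g g′ : Fin k → Fin k′} →
  (∀ i → f i ≡ f′ i) → (∀ h → g h ≡ g′ h) → ∀ x → map↑ f g x ≡ map↑ f′ g′ x
map↑-cong {m} {m′} {k} {k′} f≗f′ g≗g′ x =
  cong (join m′ k′) (Sum.map-cong f≗f′ g≗g′ (splitAt m x))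

map↑-from-to : ∀ {A B C D} (φ : Iso A B) (ψ : Iso C D) x →
  map↑ (from φ) (from ψ) (map↑ (to φ) (to ψ) x) ≡ x
map↑-from-to {A} {B} {C} {D} φ ψ x with ↑-view {n A} {n C} x
... | inj₁ (i , refl) = begin
  map↑ (from φ) (from ψ) (map↑ (to φ) (to ψ) (i ↑ˡ n C))
    ≡⟨ cong (map↑ (from φ) (from ψ)) (map↑-↑ˡ (to φ) (to ψ) i) ⟩
  map↑ (from φ) (from ψ) (to φ i ↑ˡ n D)
    ≡⟨ map↑-↑ˡ (from φ) (from ψ) (to φ i) ⟩
  from φ (to φ i) ↑ˡ n C
    ≡⟨ cong (_↑ˡ n C) (from-to φ i) ⟩
  i ↑ˡ n C ∎
  where open ≡-Reasoning
... | inj₂ (h , refl) = begin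
  map↑ (from φ) (from ψ) (map↑ (to φ) (to ψ) (n A ↑ʳ h))
    ≡⟨ cong (map↑ (from φ) (from ψ)) (map↑-↑ʳ (to φ) (to ψ) h) ⟩
  map↑ (from φ) (from ψ) (n B ↑ʳ to ψ h)
    ≡⟨ map↑-↑ʳ (from φ) (from ψ) (to ψ h) ⟩
  n A ↑ʳ from ψ (to ψ h)
    ≡⟨ cong (n A ↑ʳ_) (from-to ψ h) ⟩
  n A ↑ʳ h ∎
  where open ≡-Reasoning

module _ (S : SplitGraph) (H : Graph) where
  private
    m = n (graph S)
    k = n H

  ∘G-adjˡˡ : ∀ i j → adj (S ∘G H) (i ↑ˡ k) (j ↑ˡ k) ≡ adj (graph S) i j
  ∘G-adjˡˡ i j rewrite splitAt-↑ˡ m i k | splitAt-↑ˡ m j k = refl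

  ∘G-adjˡʳ : ∀ i h → adj (S ∘G H) (i ↑ˡ k) (m ↑ʳ h) ≡ inA S i
  ∘G-adjˡʳ i h rewrite splitAt-↑ˡ m i k | splitAt-↑ʳ m k h = refl

  ∘G-adjʳˡ : ∀ h i → adj (S ∘G H) (m ↑ʳ h) (i ↑ˡ k) ≡ inA S i
  ∘G-adjʳˡ h i rewrite splitAt-↑ʳ m k h | splitAt-↑ˡ m i k = refl

  ∘G-adjʳʳ : ∀ h h′ → adj (S ∘G H) (m ↑ʳ h) (m ↑ʳ h′) ≡ adj H h h′
  ∘G-adjʳʳ h h′ rewrite splitAt-↑ʳ m k h | splitAt-↑ʳ m k h′ = refl

record SplitIso (S T : SplitGraph) : Set where
  field
    graphIso : Iso (graph S) (graph T)
    inA-pres : ∀ i → inA T (to graphIso i) ≡ inA S i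
open SplitIso

SplitIso-refl : ∀ {S} → SplitIso S S
SplitIso-refl = record { graphIso = Iso-refl ; inA-pres = λ _ → refl }

∘G-cong : ∀ {S S′ H H′} → SplitIso S S′ → Iso H H′ → Iso (S ∘G H) (S′ ∘G H′)
∘G-cong {S} {S′} {H} {H′} φ ψ = record
  { to = map↑ (to φ₀) (to ψ)
  ; from = map↑ (from φ₀) (from ψ)
  ; from-to = map↑-from-to φ₀ ψ
  ; to-from = map↑-from-to (Iso-sym φ₀) (Iso-sym ψ)
  ; adj-pres = adj-map↑
  }
  where
  φ₀ = graphIso φ
  m = n (graph S)
  k = n H
  adj-map↑ : ∀ x y → adj (S′ ∘G H′) (map↑ (to φ₀) (to ψ) x) (map↑ (to φ₀) (to ψ) y)
                   ≡ adj (S ∘G H) x y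
  adj-map↑ x y with ↑-view {m} {k} x | ↑-view {m} {k} y
  ... | inj₁ (i , refl) | inj₁ (j , refl)
    rewrite map↑-↑ˡ (to φ₀) (to ψ) i | map↑-↑ˡ (to φ₀) (to ψ) j
          | ∘G-adjˡˡ S′ H′ (to φ₀ i) (to φ₀ j) | ∘G-adjˡˡ S H i j = adj-pres φ₀ i j
  ... | inj₁ (i , refl) | inj₂ (h , refl)
    rewrite map↑-↑ˡ (to φ₀) (to ψ) i | map↑-↑ʳ (to φ₀) (to ψ) h
          | ∘G-adjˡʳ S′ H′ (to φ₀ i) (to ψ h) | ∘G-adjˡʳ S H i h = inA-pres φ i
  ... | inj₂ (h , refl) | inj₁ (i , refl)
    rewrite map↑-↑ʳ (to φ₀) (to ψ) h | map↑-↑ˡ (to φ₀) (to ψ) i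
          | ∘G-adjʳˡ S′ H′ (to ψ h) (to φ₀ i) | ∘G-adjʳˡ S H h i = inA-pres φ i
  ... | inj₂ (h , refl) | inj₂ (h′ , refl)
    rewrite map↑-↑ʳ (to φ₀) (to ψ) h | map↑-↑ʳ (to φ₀) (to ψ) h′
          | ∘G-adjʳʳ S′ H′ (to ψ h) (to ψ h′) | ∘G-adjʳʳ S H h h′ = adj-pres ψ h h′

SplitIso-sym : ∀ {S T} → SplitIso S T → SplitIso T S
SplitIso-sym {S} {T} φ = record
  { graphIso = Iso-sym φ₀
  ; inA-pres = λ i → trans (sym (inA-pres φ (from φ₀ i))) (cong (inA T) (to-from φ₀ i)) }
  where φ₀ = graphIso φ

composeAll-cong : ∀ {X Y} Ss → Iso X Y → Iso (composeAll X Ss) (composeAll Y Ss)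
composeAll-cong []       φ = φ
composeAll-cong (S ∷ Ss) φ = composeAll-cong Ss (∘G-cong SplitIso-refl φ)

emptyGraph : Graph
emptyGraph = record { n = 0 ; adj = λ () ; adj-sym = λ () ; irrefl = λ () }

∘G-identityʳ : ∀ S → Iso (graph S) (S ∘G emptyGraph)
∘G-identityʳ S = record
  { to = _↑ˡ 0
  ; from = left
  ; from-to = λ i → cong (fromInj₁ noVertex) (splitAt-↑ˡ m i 0)
  ; to-from = to-left
  ; adj-pres = ∘G-adjˡˡ S emptyGraph }
  where
  m = n (graph S)
  noVertex : Fin 0 → Fin m
  noVertex ()
  left : Fin (m + 0) → Fin m
  left = fromInj₁ noVertex ∘ splitAt m
  to-left : ∀ x → left x ↑ˡ 0 ≡ x
  to-left x with ↑-view {m} {0} x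
  ... | inj₁ (i , refl) = cong ((_↑ˡ 0) ∘ fromInj₁ noVertex) (splitAt-↑ˡ m i 0)
  ... | inj₂ (() , _)

-- Automorphisms of a composition

module Restriction {X G : Graph} (e : Fin (n X) → Fin (n G))
  (e-injective : ∀ {x y} → e x ≡ e y → x ≡ y)
  (e-adj : ∀ x y → adj G (e x) (e y) ≡ adj X x y)
  (stable : ∀ (σ : Aut G) x → ∃ λ y → to σ (e x) ≡ e y)
  where

  private
    r : Aut G → Fin (n X) → Fin (n X)
    r σ x = proj₁ (stable σ x)

  e-restrict : ∀ σ x → e (r σ x) ≡ to σ (e x)
  e-restrict σ x = sym (proj₂ (stable σ x))

  restrict : Aut G → Aut X
  restrict σ = record
    { to = r σ
    ; from = r σ⁻¹
    ; from-to = λ x → e-injective (trans (e-restrict σ⁻¹ (r σ x))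
                  (trans (cong (from σ) (e-restrict σ x)) (from-to σ (e x))))
    ; to-from = λ x → e-injective (trans (e-restrict σ (r σ⁻¹ x))
                  (trans (cong (to σ) (e-restrict σ⁻¹ x)) (to-from σ (e x))))
    ; adj-pres = λ x y → begin
        adj X (r σ x) (r σ y)             ≡⟨ e-adj (r σ x) (r σ y) ⟨
        adj G (e (r σ x)) (e (r σ y))     ≡⟨ cong₂ (adj G) (e-restrict σ x) (e-restrict σ y) ⟩
        adj G (to σ (e x)) (to σ (e y))   ≡⟨ adj-pres σ (e x) (e y) ⟩
        adj G (e x) (e y)                 ≡⟨ e-adj x y ⟩
        adj X x y                         ∎
    }
    where
    σ⁻¹ = invᴬ G σ
    open ≡-Reasoning

  restrict-cong : ∀ {σ τ} → (∀ x → to σ x ≡ to τ x) → ∀ x → to (restrict σ) x ≡ to (restrict τ) x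
  restrict-cong {σ} {τ} σ≗τ x =
    e-injective (trans (e-restrict σ x) (trans (σ≗τ (e x)) (sym (e-restrict τ x))))

  restrict-homo : ∀ σ τ x → to (restrict (_·ᴬ_ G σ τ)) x ≡ to (restrict σ) (to (restrict τ) x)
  restrict-homo σ τ x = e-injective (trans (e-restrict (_·ᴬ_ G σ τ) x)
    (sym (trans (e-restrict σ (r τ x)) (cong (to σ) (e-restrict τ x)))))

PreservesA : SplitGraph → Set
PreservesA S = ∀ (τ : Aut (graph S)) i → inA S (to τ i) ≡ inA S i

module _ (S : SplitGraph) (H : Graph) where
  private
    m = n (graph S)
    k = n H

  KeepsLeft : Set
  KeepsLeft = ∀ (σ : Aut (S ∘G H)) i → ∃ λ j → to σ (i ↑ˡ k) ≡ j ↑ˡ k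

  keepsRight : KeepsLeft → ∀ (σ : Aut (S ∘G H)) h → ∃ λ h′ → to σ (m ↑ʳ h) ≡ m ↑ʳ h′
  keepsRight keepsLeft σ h with ↑-view {m} {k} (to σ (m ↑ʳ h))
  ... | inj₂ r = r
  ... | inj₁ (i , σh≡i) with keepsLeft (invᴬ (S ∘G H) σ) i
  ...   | j , σ⁻¹i≡j = contradiction
          (trans (sym σ⁻¹i≡j) (trans (cong (from σ) (sym σh≡i)) (from-to σ (m ↑ʳ h))))
          ↑ˡ≢↑ʳ

  Aut-∘G : KeepsLeft → PreservesA S →
           AutGroup (S ∘G H) ≃ᴳ (AutGroup (graph S) ×ᴳ AutGroup H)
  Aut-∘G keepsLeft preservesA = record
    { to = λ σ → L.restrict σ , R.restrict σ
    ; from = λ (α , β) → extend α β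
    ; to-cong = λ σ≗τ → L.restrict-cong σ≗τ , R.restrict-cong σ≗τ
    ; from-cong = λ (α≗α′ , β≗β′) → map↑-cong α≗α′ β≗β′
    ; to-homo = λ σ τ → L.restrict-homo σ τ , R.restrict-homo σ τ
    ; from-to = restrict-extend
    ; to-from = λ (α , β) →
        (λ i → ↑ˡ-injective k _ _
           (trans (L.e-restrict (extend α β) i) (map↑-↑ˡ (to α) (to β) i)))
      , (λ h → ↑ʳ-injective m _ _
           (trans (R.e-restrict (extend α β) h) (map↑-↑ʳ (to α) (to β) h)))
    }
    where
    module L = Restriction (_↑ˡ k) (↑ˡ-injective k _ _) (∘G-adjˡˡ S H) keepsLeft
    module R = Restriction (m ↑ʳ_) (↑ʳ-injective m _ _) (∘G-adjʳʳ S H) (keepsRight keepsLeft)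

    extend : Aut (graph S) → Aut H → Aut (S ∘G H)
    extend α β = ∘G-cong (record { graphIso = α ; inA-pres = preservesA α }) β

    restrict-extend : ∀ σ x → to (extend (L.restrict σ) (R.restrict σ)) x ≡ to σ x
    restrict-extend σ x with ↑-view {m} {k} x
    ... | inj₁ (i , refl) =
      trans (map↑-↑ˡ (to (L.restrict σ)) (to (R.restrict σ)) i) (L.e-restrict σ i)
    ... | inj₂ (h , refl) =
      trans (map↑-↑ʳ (to (L.restrict σ)) (to (R.restrict σ)) h) (R.e-restrict σ h)

-- Universal and isolated vertices

-- v is universal (b = true) or isolated (b = false).
Uniform : (X : Graph) → Bool → Fin (n X) → Set
Uniform X b v = ∀ w → v ≢ w → adj X v w ≡ b

NoUniform : Graph → Bool → Set
NoUniform X b = ∀ v → ¬ Uniform X b v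

Uniform-iso : ∀ {X Y b v} (φ : Iso X Y) → Uniform X b v → Uniform Y b (to φ v)
Uniform-iso {X} {Y} {b} {v} φ uniform w φv≢w = begin
  adj Y (to φ v) w                 ≡⟨ cong (adj Y (to φ v)) (to-from φ w) ⟨
  adj Y (to φ v) (to φ (from φ w)) ≡⟨ adj-pres φ v (from φ w) ⟩
  adj X v (from φ w)               ≡⟨ uniform (from φ w) v≢φ⁻¹w ⟩
  b                                ∎
  where
  open ≡-Reasoning
  v≢φ⁻¹w : v ≢ from φ w
  v≢φ⁻¹w v≡φ⁻¹w = φv≢w (trans (cong (to φ) v≡φ⁻¹w) (to-from φ w))

NoUniform-iso : ∀ {X Y b} → Iso X Y → NoUniform X b → NoUniform Y b
NoUniform-iso φ noUniform v = noUniform (from φ v) ∘ Uniform-iso (Iso-sym φ)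

another : ∀ {m} → 2 ≤ m → (v : Fin m) → ∃ λ w → v ≢ w
another (s≤s (s≤s _)) zero    = suc zero , λ ()
another (s≤s (s≤s _)) (suc _) = zero , λ ()

module _ (S : SplitGraph) (H : Graph) where
  private
    m = n (graph S)
    k = n H

  Uniform-↑ˡ : ∀ {b i} → Uniform (S ∘G H) b (i ↑ˡ k) → Uniform (graph S) b i
  Uniform-↑ˡ {b} {i} uniform j i≢j =
    trans (sym (∘G-adjˡˡ S H i j)) (uniform (j ↑ˡ k) (i≢j ∘ ↑ˡ-injective k i j))

  Uniform-↑ʳ : ∀ {b h} → Uniform (S ∘G H) b (m ↑ʳ h) → Uniform H b h
  Uniform-↑ʳ {b} {h} uniform h′ h≢h′ =
    trans (sym (∘G-adjʳʳ S H h h′)) (uniform (m ↑ʳ h′) (h≢h′ ∘ ↑ʳ-injective m h h′))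

  Uniform-↑ʳ-inA : ∀ {b h} → Uniform (S ∘G H) b (m ↑ʳ h) → ∀ i → inA S i ≡ b
  Uniform-↑ʳ-inA {b} {h} uniform i =
    trans (sym (∘G-adjʳˡ S H h i)) (uniform (i ↑ˡ k) (↑ˡ≢↑ʳ ∘ sym))

  keepsLeft-uniform : ∀ b → (∀ i → Uniform (S ∘G H) b (i ↑ˡ k)) → NoUniform H b →
                      KeepsLeft S H
  keepsLeft-uniform b left-uniform noUniform σ i with ↑-view {m} {k} (to σ (i ↑ˡ k))
  ... | inj₁ stays = stays
  ... | inj₂ (h , σi≡h) = contradiction
          (Uniform-↑ʳ (subst (Uniform (S ∘G H) b) σi≡h (Uniform-iso σ (left-uniform i))))
          (noUniform h)

  Uniform-↑ʳ⁺ : ∀ {c h} → (∀ i → inA S i ≡ c) → Uniform H c h → Uniform (S ∘G H) c (m ↑ʳ h)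
  Uniform-↑ʳ⁺ {c} {h} inA≡c uniform w h≢w with ↑-view {m} {k} w
  ... | inj₁ (i , refl)  = trans (∘G-adjʳˡ S H h i) (inA≡c i)
  ... | inj₂ (h′ , refl) = trans (∘G-adjʳʳ S H h h′) (uniform h′ (h≢w ∘ cong (m ↑ʳ_)))

-- Complete and edgeless components

-- S is complete with KS-partition (V, ∅) (c = true) or edgeless with (∅, V) (c = false).
record Homogeneous (S : SplitGraph) (c : Bool) : Set where
  field
    inA-const   : ∀ i → inA S i ≡ c
    all-uniform : ∀ i → Uniform (graph S) c i
open Homogeneous

Homogeneous-iso : ∀ {S T c} → SplitIso S T → Homogeneous S c → Homogeneous T c
Homogeneous-iso {S} {T} {c} φ homogeneous = record
  { inA-const = λ i → begin
      inA T i                   ≡⟨ cong (inA T) (to-from φ₀ i) ⟨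
      inA T (to φ₀ (from φ₀ i)) ≡⟨ inA-pres φ (from φ₀ i) ⟩
      inA S (from φ₀ i)         ≡⟨ inA-const homogeneous (from φ₀ i) ⟩
      c                         ∎
  ; all-uniform = λ i → subst (Uniform (graph T) c) (to-from φ₀ i)
                          (Uniform-iso φ₀ (all-uniform homogeneous (from φ₀ i)))
  }
  where
  φ₀ = graphIso φ
  open ≡-Reasoning

Homogeneous-preservesA : ∀ {S c} → Homogeneous S c → PreservesA S
Homogeneous-preservesA homogeneous τ i =
  trans (inA-const homogeneous (to τ i)) (sym (inA-const homogeneous i))

module _ {S c} (homogeneous : Homogeneous S c) (H : Graph) where
  private
    m = n (graph S)
    k = n H

  Homogeneous-left-uniform : ∀ i → Uniform (S ∘G H) c (i ↑ˡ k)
  Homogeneous-left-uniform i w i≢w with ↑-view {m} {k} w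
  ... | inj₁ (j , refl) =
    trans (∘G-adjˡˡ S H i j) (all-uniform homogeneous i j (i≢w ∘ cong (_↑ˡ k)))
  ... | inj₂ (h , refl) = trans (∘G-adjˡʳ S H i h) (inA-const homogeneous i)

  Homogeneous-keepsLeft : NoUniform H c → KeepsLeft S H
  Homogeneous-keepsLeft = keepsLeft-uniform S H c Homogeneous-left-uniform

  Homogeneous-∘G-noUniform : 1 ≤ m → 2 ≤ m + k → NoUniform (S ∘G H) (not c)
  Homogeneous-∘G-noUniform 1≤m 2≤m+k v uniform with ↑-view {m} {k} v
  ... | inj₁ (i , refl) =
    let (w , v≢w) = another 2≤m+k v
    in not-¬ refl (trans (sym (Homogeneous-left-uniform i w v≢w)) (uniform w v≢w))
  ... | inj₂ (h , refl) =
    let i = fromℕ< 1≤m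
    in not-¬ refl (trans (sym (inA-const homogeneous i)) (Uniform-↑ʳ-inA S H uniform i))

isK₁ : SType → Bool
isK₁ K₁ = true
isK₁ S₁ = false

runComponent-homogeneous : ∀ t m → Homogeneous (runComponent t m) (isK₁ t)
runComponent-homogeneous K₁ m = record
  { inA-const = λ _ → refl ; all-uniform = λ i j i≢j → clique (completeSplit m) i j i≢j refl refl }
runComponent-homogeneous S₁ m = record
  { inA-const = λ _ → refl ; all-uniform = λ _ _ _ → refl }

runComponent-order : ∀ t m → n (graph (runComponent t m)) ≡ m
runComponent-order K₁ m = refl
runComponent-order S₁ m = refl

reindex : (S : SplitGraph) {m : ℕ} → n (graph S) ≡ m → SplitGraph
reindex S {m} e = record
  { graph = record
    { n = m
    ; adj = λ i j → adj (graph S) (back i) (back j)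
    ; adj-sym = λ i j → adj-sym (graph S) (back i) (back j)
    ; irrefl = irrefl (graph S) ∘ back }
  ; inA = inA S ∘ back
  ; clique = λ i j i≢j → clique S (back i) (back j) (i≢j ∘ subst-injective (sym e))
  ; indep = λ i j → indep S (back i) (back j) }
  where
  back : Fin m → Fin (n (graph S))
  back = subst Fin (sym e)

reindex-iso : (S : SplitGraph) {m : ℕ} (e : n (graph S) ≡ m) → SplitIso S (reindex S e)
reindex-iso S e = record
  { graphIso = record
    { to = subst Fin e
    ; from = subst Fin (sym e)
    ; from-to = λ _ → subst-sym-subst e
    ; to-from = λ _ → subst-subst-sym e
    ; adj-pres = λ _ _ → cong₂ (adj (graph S)) (subst-sym-subst e) (subst-sym-subst e) }
  ; inA-pres = λ _ → cong (inA S) (subst-sym-subst e) }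

-- runComponent t m, reindexed so that its vertex count is m by computation even for a variable t;
-- runs can then be merged along the identity map.
Run : SType → ℕ → SplitGraph
Run t m = reindex (runComponent t m) (runComponent-order t m)

Run-homogeneous : ∀ t m → Homogeneous (Run t m) (isK₁ t)
Run-homogeneous t m =
  Homogeneous-iso (reindex-iso (runComponent t m) (runComponent-order t m))
    (runComponent-homogeneous t m)

Run-merge : ∀ t p B → Iso (Run t 1 ∘G (Run t p ∘G B)) (Run t (suc p) ∘G B)
Run-merge t p B = record
  { to = id ; from = id ; from-to = λ _ → refl ; to-from = λ _ → refl ; adj-pres = agree }
  where
  c = isK₁ t
  L = Run t 1 ∘G (Run t p ∘G B)
  R = Run t (suc p) ∘G B

  run-vertex-uniformL : ∀ i → Uniform L c (i ↑ˡ n B)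
  run-vertex-uniformL zero    = Homogeneous-left-uniform (Run-homogeneous t 1) (Run t p ∘G B) zero
  run-vertex-uniformL (suc i) =
    Uniform-↑ʳ⁺ (Run t 1) (Run t p ∘G B) (inA-const (Run-homogeneous t 1))
      (Homogeneous-left-uniform (Run-homogeneous t p) B i)

  agree-at-run-vertex : ∀ i y → adj R (i ↑ˡ n B) y ≡ adj L (i ↑ˡ n B) y
  agree-at-run-vertex i y with i ↑ˡ n B ≟ y
  ... | yes refl = trans (irrefl R (i ↑ˡ n B)) (sym (irrefl L (i ↑ˡ n B)))
  ... | no i≢y   = trans (Homogeneous-left-uniform (Run-homogeneous t (suc p)) B i y i≢y)
                         (sym (run-vertex-uniformL i y i≢y))

  agree : ∀ x y → adj R x y ≡ adj L x y
  agree x y with ↑-view {suc p} {n B} x | ↑-view {suc p} {n B} y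
  ... | inj₁ (i , refl) | _               = agree-at-run-vertex i y
  ... | inj₂ _          | inj₁ (j , refl) =
    trans (adj-sym R x (j ↑ˡ n B)) (trans (agree-at-run-vertex j x) (adj-sym L (j ↑ˡ n B) x))
  ... | inj₂ (h , refl) | inj₂ (h′ , refl) = begin
    adj R (suc p ↑ʳ h) (suc p ↑ʳ h′)
      ≡⟨ ∘G-adjʳʳ (Run t (suc p)) B h h′ ⟩
    adj B h h′
      ≡⟨ ∘G-adjʳʳ (Run t p) B h h′ ⟨
    adj (Run t p ∘G B) (p ↑ʳ h) (p ↑ʳ h′)
      ≡⟨ ∘G-adjʳʳ (Run t 1) (Run t p ∘G B) (p ↑ʳ h) (p ↑ʳ h′) ⟨
    adj L (1 ↑ʳ (p ↑ʳ h)) (1 ↑ʳ (p ↑ʳ h′)) ∎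
    where open ≡-Reasoning

runComponent-merge : ∀ t p B →
  Iso (runComponent t 1 ∘G (runComponent t p ∘G B)) (runComponent t (suc p) ∘G B)
runComponent-merge t p B =
  Iso-trans (∘G-cong (toRun 1) (∘G-cong (toRun p) Iso-refl))
    (Iso-trans (Run-merge t p B) (∘G-cong (SplitIso-sym (toRun (suc p))) Iso-refl))
  where
  toRun : ∀ m → SplitIso (runComponent t m) (Run t m)
  toRun m = reindex-iso (runComponent t m) (runComponent-order t m)

-- Decompositions from vertex partitions

1≤-of-Fin : ∀ {k} → Fin k → 1 ≤ k
1≤-of-Fin {suc _} _ = s≤s z≤n

record Partition {m : ℕ} (P : Fin m → Set) : Set where
  field
    k l           : ℕ
    split         : Fin m → Fin k ⊎ Fin l
    unsplit       : Fin k ⊎ Fin l → Fin m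
    unsplit-split : ∀ x → unsplit (split x) ≡ x
    split-unsplit : ∀ u → split (unsplit u) ≡ u
    P-inj₁        : ∀ i → P (unsplit (inj₁ i))
    ¬P-inj₂       : ∀ j → ¬ P (unsplit (inj₂ j))

  unsplit-injective : ∀ {u v} → unsplit u ≡ unsplit v → u ≡ v
  unsplit-injective {u} {v} eq =
    trans (sym (split-unsplit u)) (trans (cong split eq) (split-unsplit v))

  private
    unsplit-from : ∀ {x u} → split x ≡ u → unsplit u ≡ x
    unsplit-from {x} refl = unsplit-split x

  k-positive : ∀ {x} → P x → 1 ≤ k
  k-positive {x} Px with split x in eq
  ... | inj₁ i = 1≤-of-Fin i
  ... | inj₂ j = contradiction (subst P (sym (unsplit-from eq)) Px) (¬P-inj₂ j)

  l-positive : ∀ {x} → ¬ P x → 1 ≤ l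
  l-positive {x} ¬Px with split x in eq
  ... | inj₁ i = contradiction (subst P (unsplit-from eq) (P-inj₁ i)) ¬Px
  ... | inj₂ j = 1≤-of-Fin j

module _ {m : ℕ} {P : Fin m → Set} where

  swapPartition : Partition P → Partition (¬_ ∘ P)
  swapPartition Π = record
    { k = l
    ; l = k
    ; split = Sum.swap ∘ split
    ; unsplit = unsplit ∘ Sum.swap
    ; unsplit-split = λ x → trans (cong unsplit (Sum.swap-involutive (split x))) (unsplit-split x)
    ; split-unsplit = λ u →
        trans (cong Sum.swap (split-unsplit (Sum.swap u))) (Sum.swap-involutive u)
    ; P-inj₁ = ¬P-inj₂
    ; ¬P-inj₂ = λ i ¬P → ¬P (P-inj₁ i) }
    where open Partition Π

  Partition-resp : ∀ {Q : Fin m → Set} → (∀ {x} → P x → Q x) → (∀ {x} → Q x → P x) →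
                   Partition P → Partition Q
  Partition-resp P⇒Q Q⇒P Π = record
    { Partition Π
    ; P-inj₁ = P⇒Q ∘ P-inj₁
    ; ¬P-inj₂ = λ j → ¬P-inj₂ j ∘ Q⇒P }
    where open Partition Π

consPartition : ∀ {m} {P : Fin (suc m) → Set} → P zero → Partition (P ∘ suc) → Partition P
consPartition {m} {P} P₀ Π = record
  { k = suc k
  ; l = l
  ; split = split′
  ; unsplit = unsplit′
  ; unsplit-split = unsplit-split′
  ; split-unsplit = split-unsplit′
  ; P-inj₁ = λ { zero → P₀ ; (suc i) → P-inj₁ i }
  ; ¬P-inj₂ = ¬P-inj₂ }
  where
  open Partition Π
  split′ : Fin (suc m) → Fin (suc k) ⊎ Fin l
  split′ zero    = inj₁ zero
  split′ (suc x) = Sum.map₁ suc (split x)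
  unsplit′ : Fin (suc k) ⊎ Fin l → Fin (suc m)
  unsplit′ (inj₁ zero)    = zero
  unsplit′ (inj₁ (suc i)) = suc (unsplit (inj₁ i))
  unsplit′ (inj₂ j)       = suc (unsplit (inj₂ j))
  unsplit′-map₁ : ∀ u → unsplit′ (Sum.map₁ suc u) ≡ suc (unsplit u)
  unsplit′-map₁ (inj₁ _) = refl
  unsplit′-map₁ (inj₂ _) = refl
  unsplit-split′ : ∀ x → unsplit′ (split′ x) ≡ x
  unsplit-split′ zero    = refl
  unsplit-split′ (suc x) = trans (unsplit′-map₁ (split x)) (cong suc (unsplit-split x))
  split-unsplit′ : ∀ u → split′ (unsplit′ u) ≡ u
  split-unsplit′ (inj₁ zero)    = refl
  split-unsplit′ (inj₁ (suc i)) = cong (Sum.map₁ suc) (split-unsplit (inj₁ i))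
  split-unsplit′ (inj₂ j)       = cong (Sum.map₁ suc) (split-unsplit (inj₂ j))

partition : ∀ {m} {P : Fin m → Set} → Decidable P → Partition P
partition {zero} P? = record
  { k = 0 ; l = 0 ; split = λ () ; unsplit = λ { (inj₁ ()) ; (inj₂ ()) }
  ; unsplit-split = λ () ; split-unsplit = λ { (inj₁ ()) ; (inj₂ ()) }
  ; P-inj₁ = λ () ; ¬P-inj₂ = λ () }
partition {suc m} {P} P? with P? zero
... | yes P₀ = consPartition P₀ (partition (P? ∘ suc))
-- zero belongs to the second part: partition by ¬ P and swap the parts back
... | no ¬P₀ = Partition-resp (decidable-stable (P? _)) (λ Px ¬Px → ¬Px Px)
  (swapPartition (consPartition {P = ¬_ ∘ P} ¬P₀ (swapPartition (partition (P? ∘ suc)))))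

induced : (X : Graph) {k : ℕ} → (Fin k → Fin (n X)) → Graph
induced X {k} f = record
  { n = k
  ; adj = λ i j → adj X (f i) (f j)
  ; adj-sym = λ i j → adj-sym X (f i) (f j)
  ; irrefl = irrefl X ∘ f }

module _ (X : Graph) {InS : Fin (n X) → Set} (InS? : Decidable InS) (a : Fin (n X) → Bool)
  (clique′ : ∀ {x y} → InS x → InS y → x ≢ y → a x ≡ true → a y ≡ true → adj X x y ≡ true)
  (indep′  : ∀ {x y} → InS x → InS y → a x ≡ false → a y ≡ false → adj X x y ≡ false)
  (cross   : ∀ {x y} → InS x → ¬ InS y → adj X x y ≡ a x)
  where

  decomposable-byParts : ∀ {x y} → InS x → ¬ InS y → Decomposable X
  decomposable-byParts x∈S y∉S = S , H , k-positive x∈S , l-positive y∉S , record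
    { to = join k l ∘ split
    ; from = unsplit ∘ splitAt k
    ; from-to = λ x → trans (cong unsplit (splitAt-join k l (split x))) (unsplit-split x)
    ; to-from = λ y → trans (cong (join k l) (split-unsplit (splitAt k y))) (join-splitAt k l y)
    ; adj-pres = λ x y → trans (adj-join (split x) (split y))
                           (cong₂ (adj X) (unsplit-split x) (unsplit-split y))
    }
    where
    open Partition (partition InS?)
    S : SplitGraph
    S = record
      { graph = induced X (unsplit ∘ inj₁)
      ; inA = a ∘ unsplit ∘ inj₁
      ; clique = λ i j i≢j →
          clique′ (P-inj₁ i) (P-inj₁ j) (i≢j ∘ Sum.inj₁-injective ∘ unsplit-injective)
      ; indep = λ i j → indep′ (P-inj₁ i) (P-inj₁ j) }
    H : Graph
    H = induced X (unsplit ∘ inj₂)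
    adj-join : ∀ u v → adj (S ∘G H) (join k l u) (join k l v) ≡ adj X (unsplit u) (unsplit v)
    adj-join (inj₁ i) (inj₁ j) = ∘G-adjˡˡ S H i j
    adj-join (inj₁ i) (inj₂ j) = trans (∘G-adjˡʳ S H i j) (sym (cross (P-inj₁ i) (¬P-inj₂ j)))
    adj-join (inj₂ j) (inj₁ i) = trans (∘G-adjʳˡ S H j i)
      (sym (trans (adj-sym X _ _) (cross (P-inj₁ i) (¬P-inj₂ j))))
    adj-join (inj₂ i) (inj₂ j) = ∘G-adjʳʳ S H i j

-- Indecomposable components

NontrivialIndecomposable : Graph → Set
NontrivialIndecomposable X = 2 ≤ n X × Indecomposable X

NontrivialIndecomposable-noUniform : ∀ {X} → NontrivialIndecomposable X → ∀ c → NoUniform X c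
NontrivialIndecomposable-noUniform {X} (2≤n , indec) c v uniform =
  indec (decomposable-byParts X (_≟ v) (const c) clique′ indep′ cross
    (refl {x = v}) (v≢w ∘ sym))
  where
  v≢w = proj₂ (another 2≤n v)
  clique′ : ∀ {x y} → x ≡ v → y ≡ v → x ≢ y → c ≡ true → c ≡ true → adj X x y ≡ true
  clique′ x≡v y≡v x≢y _ _ = contradiction (trans x≡v (sym y≡v)) x≢y
  indep′ : ∀ {x y} → x ≡ v → y ≡ v → c ≡ false → c ≡ false → adj X x y ≡ false
  indep′ refl refl _ _ = irrefl X v
  cross : ∀ {x y} → x ≡ v → y ≢ v → adj X x y ≡ c
  cross refl y≢v = uniform _ (y≢v ∘ sym)

IsKSPartition : (X : Graph) → (Fin (n X) → Bool) → Set
IsKSPartition X a = (∀ i j → i ≢ j → a i ≡ true → a j ≡ true → adj X i j ≡ true)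
                  × (∀ i j → a i ≡ false → a j ≡ false → adj X i j ≡ false)

IsKSPartition-aut : ∀ {X a} (τ : Aut X) → IsKSPartition X a → IsKSPartition X (a ∘ to τ)
IsKSPartition-aut {X} τ (clique′ , indep′) =
  (λ i j i≢j ai aj →
     trans (sym (adj-pres τ i j)) (clique′ _ _ (i≢j ∘ Iso-to-injective τ) ai aj)) ,
  (λ i j ai aj → trans (sym (adj-pres τ i j)) (indep′ _ _ ai aj))

module _ (S : SplitGraph) (nontrivial : NontrivialIndecomposable (graph S)) where
  private
    X = graph S
    v₀ : Fin (n X)
    v₀ = fromℕ< (≤-trans (s≤s z≤n) (proj₁ nontrivial))

  sides-distinct : ∀ {a b} → inA S a ≡ true → inA S b ≡ false → a ≢ b
  sides-distinct a∈A b∈B a≡b =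
    contradiction (trans (sym a∈A) (trans (cong (inA S) a≡b) b∈B)) λ ()

  -- Otherwise S would decompose as (S − v) ∘ {v}.
  disagreeing : ∀ v → ∃ λ x → x ≢ v × adj X x v ≡ not (inA S x)
  disagreeing v = x , x≢v , ¬-not adj≢inA
    where
    Agrees : Fin (n X) → Set
    Agrees x = x ≢ v → adj X x v ≡ inA S x
    ¬allAgree : ¬ (∀ x → Agrees x)
    ¬allAgree agree = proj₂ nontrivial (decomposable-byParts X (λ x → ¬? (x ≟ v)) (inA S)
      (λ _ _ → clique S _ _) (λ _ _ → indep S _ _)
      (λ {x} {y} x≢v ¬y≢v →
         subst (λ z → adj X x z ≡ inA S x) (sym (decidable-stable (y ≟ v) ¬y≢v)) (agree x x≢v))
      (proj₂ (another (proj₁ nontrivial) v) ∘ sym) (λ v≢v → v≢v refl))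
    disagreement = ¬∀⟶∃¬ (n X) Agrees (λ x → ¬? (x ≟ v) →-dec (adj X x v Bool.≟ inA S x)) ¬allAgree
    x = proj₁ disagreement
    x≢v : x ≢ v
    x≢v x≡v = proj₂ disagreement λ x≢v → contradiction x≡v x≢v
    adj≢inA : adj X x v ≢ inA S x
    adj≢inA eq = proj₂ disagreement λ _ → eq

  A-vertex-has-B-neighbour : ∀ {a} → inA S a ≡ true → ∃ λ b → inA S b ≡ false × adj X b a ≡ true
  A-vertex-has-B-neighbour {a} a∈A with disagreeing a
  ... | x , x≢a , adj≡ with inA S x in x∈
  ... | true  = contradiction (trans (sym adj≡) (clique S x a x≢a x∈ a∈A)) λ ()
  ... | false = x , x∈ , adj≡

  B-vertex-has-A-non-neighbour : ∀ {b} → inA S b ≡ false →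
                                 ∃ λ a → inA S a ≡ true × adj X a b ≡ false
  B-vertex-has-A-non-neighbour {b} b∈B with disagreeing b
  ... | x , x≢b , adj≡ with inA S x in x∈
  ... | true  = x , x∈ , adj≡
  ... | false = contradiction (trans (sym adj≡) (indep S x b x∈ b∈B)) λ ()

  sides-nonempty : (∃ λ a → inA S a ≡ true) × (∃ λ b → inA S b ≡ false)
  sides-nonempty with inA S v₀ in v₀∈
  ... | true  = let (b , b∈B , _) = A-vertex-has-B-neighbour v₀∈ in (v₀ , v₀∈) , (b , b∈B)
  ... | false = let (a , a∈A , _) = B-vertex-has-A-non-neighbour v₀∈ in (a , a∈A) , (v₀ , v₀∈)

  module _ {a′ : Fin (n X) → Bool} (a′-isKS : IsKSPartition X a′) where
    private
      clique′ = proj₁ a′-isKS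
      indep′  = proj₂ a′-isKS

    A⊆A′ : ∀ {x} → inA S x ≡ true → a′ x ≡ true
    A⊆A′ {x} x∈A with a′ x in x∈A′
    ... | true  = refl
    ... | false with A-vertex-has-B-neighbour x∈A
    ...   | b , b∈B , b~x with a′ b in b∈A′
    ...     | false = contradiction (trans (sym b~x) (indep′ b x b∈A′ x∈A′)) λ ()
    ...     | true with B-vertex-has-A-non-neighbour b∈B
    ...       | a , a∈A , a≁b with a′ a in a∈A′
    ...         | true = contradiction
                           (trans (sym a≁b) (clique′ a b (sides-distinct a∈A b∈B) a∈A′ b∈A′)) λ ()
    ...         | false = contradiction
                           (trans (sym (indep′ a x a∈A′ x∈A′)) (clique S a x a≢x a∈A x∈A)) λ ()
      where
      a≢x : a ≢ x
      a≢x refl = contradiction (trans (sym a≁b) (trans (adj-sym X a b) b~x)) λ ()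

    B⊆B′ : ∀ {x} → inA S x ≡ false → a′ x ≡ false
    B⊆B′ {x} x∈B with a′ x in x∈A′
    ... | false = refl
    ... | true with B-vertex-has-A-non-neighbour x∈B
    ...   | a , a∈A , a≁x = contradiction
            (trans (sym a≁x) (clique′ a x (sides-distinct a∈A x∈B) (A⊆A′ a∈A) x∈A′)) λ ()

    IsKSPartition-unique : ∀ x → a′ x ≡ inA S x
    IsKSPartition-unique x with inA S x in x∈A
    ... | true  = A⊆A′ x∈A
    ... | false = B⊆B′ x∈A

  NontrivialIndecomposable-preservesA : PreservesA S
  NontrivialIndecomposable-preservesA τ =
    IsKSPartition-unique (IsKSPartition-aut τ (clique S , indep S))

  NontrivialIndecomposable-∘G-noUniform : ∀ B c → NoUniform (S ∘G B) c
  NontrivialIndecomposable-∘G-noUniform B c v uniform with ↑-view {n X} {n B} v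
  ... | inj₁ (i , refl) = NontrivialIndecomposable-noUniform nontrivial c i (Uniform-↑ˡ S B uniform)
  ... | inj₂ (h , refl) =
    let ((a , a∈A) , (b , b∈B)) = sides-nonempty
        inA≡c = Uniform-↑ʳ-inA S B uniform
    in contradiction (trans (sym a∈A) (trans (inA≡c a) (trans (sym (inA≡c b)) b∈B))) λ ()

module _ (S : SplitGraph) (H : Graph) where
  private
    m = n (graph S)
    k = n H

  IsLeft : Fin (m + k) → Set
  IsLeft w = ∃ λ i → w ≡ i ↑ˡ k

  isLeft? : Decidable IsLeft
  isLeft? w with ↑-view {m} {k} w
  ... | inj₁ left = yes left
  ... | inj₂ (h , w≡h) = no λ (i , w≡i) → ↑ˡ≢↑ʳ (trans (sym w≡i) w≡h)

  ¬IsLeft⇒right : ∀ {w} → ¬ IsLeft w → ∃ λ h → w ≡ m ↑ʳ h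
  ¬IsLeft⇒right {w} ¬left with ↑-view {m} {k} w
  ... | inj₁ left  = contradiction left ¬left
  ... | inj₂ right = right

  module _ {X : Graph} (f : Fin (n X) → Fin (m + k))
    (f-injective : ∀ {x y} → f x ≡ f y → x ≡ y)
    (f-adj : ∀ x y → adj (S ∘G H) (f x) (f y) ≡ adj X x y)
    where

    private
      label : Fin (n X) → Bool
      label x = [ inA S , const false ]′ (splitAt m (f x))

      label-left : ∀ {x i} → f x ≡ i ↑ˡ k → label x ≡ inA S i
      label-left {x} {i} fx≡i =
        cong [ inA S , const false ]′ (trans (cong (splitAt m) fx≡i) (splitAt-↑ˡ m i k))

      adj-via : ∀ {x y u w} → f x ≡ u → f y ≡ w → adj X x y ≡ adj (S ∘G H) u w
      adj-via {x} {y} fx≡u fy≡w = trans (sym (f-adj x y)) (cong₂ (adj (S ∘G H)) fx≡u fy≡w)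

      clique′ : ∀ {x y} → IsLeft (f x) → IsLeft (f y) → x ≢ y →
                label x ≡ true → label y ≡ true → adj X x y ≡ true
      clique′ (i , fx≡i) (j , fy≡j) x≢y lx ly =
        trans (adj-via fx≡i fy≡j) (trans (∘G-adjˡˡ S H i j)
          (clique S i j i≢j (trans (sym (label-left fx≡i)) lx) (trans (sym (label-left fy≡j)) ly)))
        where
        i≢j : i ≢ j
        i≢j i≡j = x≢y (f-injective (trans fx≡i (trans (cong (_↑ˡ k) i≡j) (sym fy≡j))))

      indep′ : ∀ {x y} → IsLeft (f x) → IsLeft (f y) →
               label x ≡ false → label y ≡ false → adj X x y ≡ false
      indep′ (i , fx≡i) (j , fy≡j) lx ly =
        trans (adj-via fx≡i fy≡j) (trans (∘G-adjˡˡ S H i j)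
          (indep S i j (trans (sym (label-left fx≡i)) lx) (trans (sym (label-left fy≡j)) ly)))

      cross : ∀ {x y} → IsLeft (f x) → ¬ IsLeft (f y) → adj X x y ≡ label x
      cross (i , fx≡i) fy-right =
        let (h , fy≡h) = ¬IsLeft⇒right fy-right
        in trans (adj-via fx≡i fy≡h) (trans (∘G-adjˡʳ S H i h) (sym (label-left fx≡i)))

    embedding-decomposable : ∀ {x y} → IsLeft (f x) → ¬ IsLeft (f y) → Decomposable X
    embedding-decomposable =
      decomposable-byParts X (isLeft? ∘ f) label clique′ indep′ cross

  -- σ (a ↑ˡ k) and b ↑ˡ k would be both adjacent (transport along σ⁻¹) and non-adjacent.
  ¬all-right : (∃ λ a → inA S a ≡ true) → (∃ λ b → inA S b ≡ false) →
               (σ : Aut (S ∘G H)) → ¬ (∀ x → ¬ IsLeft (to σ (x ↑ˡ k)))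
  ¬all-right (a , a∈A) (b , b∈B) σ allRight
    with ¬IsLeft⇒right (allRight a) | ↑-view {m} {k} (from σ (b ↑ˡ k))
  ... | _ | inj₁ (j , σ⁻¹b≡j) =
    allRight j (b , trans (cong (to σ) (sym σ⁻¹b≡j)) (to-from σ (b ↑ˡ k)))
  ... | h , σa≡h | inj₂ (h′ , σ⁻¹b≡h′) = contradiction (trans (sym nonadjacent) adjacent) λ ()
    where
    G = S ∘G H
    nonadjacent : adj G (to σ (a ↑ˡ k)) (b ↑ˡ k) ≡ false
    nonadjacent = trans (cong (λ w → adj G w (b ↑ˡ k)) σa≡h) (trans (∘G-adjʳˡ S H h b) b∈B)
    adjacent : adj G (to σ (a ↑ˡ k)) (b ↑ˡ k) ≡ true
    adjacent = begin
      adj G (to σ (a ↑ˡ k)) (b ↑ˡ k)                    ≡⟨ cong (adj G _) (to-from σ (b ↑ˡ k)) ⟨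
      adj G (to σ (a ↑ˡ k)) (to σ (from σ (b ↑ˡ k)))   ≡⟨ adj-pres σ _ _ ⟩
      adj G (a ↑ˡ k) (from σ (b ↑ˡ k))                 ≡⟨ cong (adj G (a ↑ˡ k)) σ⁻¹b≡h′ ⟩
      adj G (a ↑ˡ k) (m ↑ʳ h′)                         ≡⟨ ∘G-adjˡʳ S H a h′ ⟩
      inA S a                                          ≡⟨ a∈A ⟩
      true                                             ∎
      where open ≡-Reasoning

  private
    image : Aut (S ∘G H) → Fin m → Fin (m + k)
    image σ x = to σ (x ↑ˡ k)

  NontrivialIndecomposable-keepsLeft : NontrivialIndecomposable (graph S) → KeepsLeft S H
  NontrivialIndecomposable-keepsLeft nontrivial σ i with all? (isLeft? ∘ image σ)
  ... | yes allLeft = allLeft i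
  ... | no ¬allLeft with any? (isLeft? ∘ image σ)
  ...   | yes (x , x-left) =
    let (y , y-right) = ¬∀⟶∃¬ m (IsLeft ∘ image σ) (isLeft? ∘ image σ) ¬allLeft
    in ⊥-elim (proj₂ nontrivial
         (embedding-decomposable (image σ) image-injective image-adj x-left y-right))
    where
    image-injective : ∀ {x y} → image σ x ≡ image σ y → x ≡ y
    image-injective = ↑ˡ-injective k _ _ ∘ Iso-to-injective σ
    image-adj : ∀ x y → adj (S ∘G H) (image σ x) (image σ y) ≡ adj (graph S) x y
    image-adj x y = trans (adj-pres σ (x ↑ˡ k) (y ↑ˡ k)) (∘G-adjˡˡ S H x y)
  ...   | no ¬anyLeft =
    let (A≠∅ , B≠∅) = sides-nonempty S nontrivial
    in ⊥-elim (¬all-right A≠∅ B≠∅ σ λ x x-left → ¬anyLeft (x , x-left))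

-- Chains and the compact canonical decomposition

data Layer : SplitGraph → Graph → Set where
  indecomposable : ∀ {S B} → NontrivialIndecomposable (graph S) → Layer S B
  homogeneous    : ∀ {S B c} → Homogeneous S c → NoUniform B c → Layer S B

data Chain : Graph → List SplitGraph → Set where
  []  : ∀ {B} → Chain B []
  _∷_ : ∀ {S B Ss} → Layer S B → Chain (S ∘G B) Ss → Chain B (S ∷ Ss)

Aut-layer : ∀ {S B} → Layer S B → AutGroup (S ∘G B) ≃ᴳ (AutGroup (graph S) ×ᴳ AutGroup B)
Aut-layer {S} {B} (indecomposable nontrivial) =
  Aut-∘G S B (NontrivialIndecomposable-keepsLeft S B nontrivial)
    (NontrivialIndecomposable-preservesA S nontrivial)
Aut-layer {S} {B} (homogeneous S-homogeneous noUniform) =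
  Aut-∘G S B (Homogeneous-keepsLeft S-homogeneous B noUniform)
    (Homogeneous-preservesA S-homogeneous)

Aut-composeAll : ∀ {B Ss} → Chain B Ss →
                 AutGroup (composeAll B Ss) ≃ᴳ (AutGroup B ×ᴳ AutProduct (map graph Ss))
Aut-composeAll []              = ×-identityʳ
Aut-composeAll (layer ∷ chain) =
  ≃ᴳ-trans (Aut-composeAll chain)
    (≃ᴳ-trans (×-cong (≃ᴳ-trans (Aut-layer layer) ×-comm) ≃ᴳ-refl) ×-assoc)

Chain-cong : ∀ {B B′ Ss} → Iso B B′ → Chain B Ss → Chain B′ Ss
Chain-cong φ [] = []
Chain-cong φ (indecomposable nontrivial ∷ chain) =
  indecomposable nontrivial ∷ Chain-cong (∘G-cong SplitIso-refl φ) chain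
Chain-cong φ (homogeneous S-homogeneous noUniform ∷ chain) =
  homogeneous S-homogeneous (NoUniform-iso φ noUniform)
    ∷ Chain-cong (∘G-cong SplitIso-refl φ) chain

data Classified : List SplitGraph → List Item → Set where
  []     : Classified [] []
  single : ∀ {S Ss its} t → SplitIso S (runComponent t 1) → Classified Ss its →
           Classified (S ∷ Ss) (inj₁ t ∷ its)
  large  : ∀ {S Ss its} → NontrivialIndecomposable (graph S) → Classified Ss its →
           Classified (S ∷ Ss) (inj₂ S ∷ its)

isK₁-if : ∀ b → isK₁ (if b then K₁ else S₁) ≡ b
isK₁-if true  = refl
isK₁-if false = refl

classify-cons : ∀ S {Ss its} → 1 ≤ n (graph S) → Indecomposable (graph S) →
                Classified Ss its → Classified (S ∷ Ss) (classify S ∷ its)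
classify-cons record { graph = record { n = suc (suc _) } } _ indec =
  large (s≤s (s≤s z≤n) , indec)
classify-cons S@record { graph = record { n = suc zero } ; inA = a } _ _ =
  single t (record { graphIso = Iso-order1 refl (runComponent-order t 1) ; inA-pres = inA-pres′ })
  where
  t = if a zero then K₁ else S₁
  inA-pres′ : ∀ i → inA (runComponent t 1) _ ≡ a i
  inA-pres′ zero = trans (inA-const (runComponent-homogeneous t 1) _) (isK₁-if (a zero))

classified : ∀ {Ss} → All (λ S → 1 ≤ n (graph S)) Ss → All (λ S → Indecomposable (graph S)) Ss →
             Classified Ss (map classify Ss)
classified []                   []                         = []
classified {S ∷ _} (1≤n ∷ 1≤ns) (indec ∷ indecs) =
  classify-cons S 1≤n indec (classified 1≤ns indecs)

==ᵗ-sound : ∀ {t t′} → (t ==ᵗ t′) ≡ true → t ≡ t′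
==ᵗ-sound {K₁} {K₁} _ = refl
==ᵗ-sound {S₁} {S₁} _ = refl

==ᵗ-false : ∀ {t t′} → (t ==ᵗ t′) ≡ false → isK₁ t′ ≡ not (isK₁ t)
==ᵗ-false {K₁} {S₁} _ = refl
==ᵗ-false {S₁} {K₁} _ = refl

runComponent-∘G-noUniform : ∀ t p B → 1 ≤ p → 2 ≤ p + n B →
                            NoUniform (runComponent t p ∘G B) (not (isK₁ t))
runComponent-∘G-noUniform K₁ p B = Homogeneous-∘G-noUniform (runComponent-homogeneous K₁ p) B
runComponent-∘G-noUniform S₁ p B = Homogeneous-∘G-noUniform (runComponent-homogeneous S₁ p) B

p≤order-runComponent-∘G : ∀ t p B → p ≤ n (runComponent t p ∘G B)
p≤order-runComponent-∘G K₁ p B = m≤m+n p (n B)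
p≤order-runComponent-∘G S₁ p B = m≤m+n p (n B)

pending : Maybe (SType × ℕ) → Graph → Graph
pending nothing        B = B
pending (just (t , p)) B = runComponent t p ∘G B

mergeRuns-iso : ∀ {Ss its} B acc → Classified Ss its →
                Iso (composeAll (pending acc B) Ss) (composeAll B (mergeRuns acc its))
mergeRuns-iso B nothing        []                 = Iso-refl
mergeRuns-iso B (just _)       []                 = Iso-refl
mergeRuns-iso B nothing        (large {S} _ cl)   = mergeRuns-iso (S ∘G B) nothing cl
mergeRuns-iso B (just (t , p)) (large {S} _ cl)   =
  mergeRuns-iso (S ∘G (runComponent t p ∘G B)) nothing cl
mergeRuns-iso B nothing        (single {Ss = Ss} t S≅ cl) =
  Iso-trans (composeAll-cong Ss (∘G-cong S≅ Iso-refl)) (mergeRuns-iso B (just (t , 1)) cl)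
mergeRuns-iso B (just (t , p)) (single {Ss = Ss} t′ S≅ cl) with t ==ᵗ t′ in same
... | true with refl ← ==ᵗ-sound same =
  Iso-trans (composeAll-cong Ss (Iso-trans (∘G-cong S≅ Iso-refl) (runComponent-merge t p B)))
    (mergeRuns-iso B (just (t , suc p)) cl)
... | false =
  Iso-trans (composeAll-cong Ss (∘G-cong S≅ Iso-refl))
    (mergeRuns-iso (runComponent t p ∘G B) (just (t′ , 1)) cl)

-- Invariant of mergeRuns-chain: a pending run has p ≥ 1 vertices and, with B, at least two, so
-- that the next run (of the other type) finds no uniform vertex of its type below it.
Admissible : Graph → Maybe (SType × ℕ) → List Item → Set
Admissible B nothing        (inj₁ t ∷ _) = 1 ≤ n B × NoUniform B (isK₁ t)
Admissible B nothing        _            = ⊤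
Admissible B (just (t , p)) _            = 1 ≤ p × 2 ≤ p + n B × NoUniform B (isK₁ t)

admissible-nothing : ∀ {B} → 1 ≤ n B → (∀ c → NoUniform B c) → ∀ its → Admissible B nothing its
admissible-nothing 1≤n noUniform []           = tt
admissible-nothing 1≤n noUniform (inj₁ t ∷ _) = 1≤n , noUniform (isK₁ t)
admissible-nothing 1≤n noUniform (inj₂ _ ∷ _) = tt

admissible-after : ∀ {S} B → NontrivialIndecomposable (graph S) → ∀ its →
                   Admissible (S ∘G B) nothing its
admissible-after {S} B nontrivial =
  admissible-nothing (≤-trans (s≤s z≤n) (≤-trans (proj₁ nontrivial) (m≤m+n _ _)))
    (NontrivialIndecomposable-∘G-noUniform S nontrivial B)

mergeRuns-chain : ∀ {Ss its} B acc → Classified Ss its → Admissible B acc its →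
                  Chain B (mergeRuns acc its)
mergeRuns-chain B nothing        []                   _ = []
mergeRuns-chain B (just (t , p)) []                   (_ , _ , noUniform) =
  homogeneous (runComponent-homogeneous t p) noUniform ∷ []
mergeRuns-chain B nothing        (large {its = its} nontrivial cl) _ =
  indecomposable nontrivial ∷ mergeRuns-chain _ nothing cl (admissible-after B nontrivial its)
mergeRuns-chain B (just (t , p)) (large {its = its} nontrivial cl) (_ , _ , noUniform) =
  homogeneous (runComponent-homogeneous t p) noUniform ∷ indecomposable nontrivial ∷
    mergeRuns-chain _ nothing cl (admissible-after _ nontrivial its)
mergeRuns-chain B nothing        (single t _ cl)      (1≤n , noUniform) =
  mergeRuns-chain B (just (t , 1)) cl (s≤s z≤n , s≤s 1≤n , noUniform)
mergeRuns-chain B (just (t , p)) (single t′ _ cl)     (1≤p , 2≤p+n , noUniform)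
  with t ==ᵗ t′ in same
... | true with refl ← ==ᵗ-sound same =
  mergeRuns-chain B (just (t , suc p)) cl (s≤s z≤n , m≤n⇒m≤1+n 2≤p+n , noUniform)
... | false =
  homogeneous (runComponent-homogeneous t p) noUniform ∷
    mergeRuns-chain _ (just (t′ , 1)) cl
      (s≤s z≤n , s≤s (≤-trans 1≤p (p≤order-runComponent-∘G t p B)) ,
       subst (NoUniform (runComponent t p ∘G B)) (sym (==ᵗ-false same))
         (runComponent-∘G-noUniform t p B 1≤p 2≤p+n))

mergeRuns-takeRun : ∀ t p xs → let (c , rest) = takeRun t xs in
  mergeRuns (just (t , p)) xs ≡ runComponent t (p + c) ∷ mergeRuns nothing rest
mergeRuns-takeRun t p [] = cong (λ q → runComponent t q ∷ []) (sym (+-identityʳ p))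
mergeRuns-takeRun t p (inj₂ S ∷ xs) =
  cong (λ q → runComponent t q ∷ S ∷ mergeRuns nothing xs) (sym (+-identityʳ p))
mergeRuns-takeRun t p (inj₁ t′ ∷ xs) with t ==ᵗ t′
... | true  = trans (mergeRuns-takeRun t (suc p) xs)
                (cong (λ q → runComponent t q ∷ mergeRuns nothing (proj₂ (takeRun t xs)))
                   (sym (+-suc p (proj₁ (takeRun t xs)))))
... | false = cong (λ q → runComponent t q ∷ mergeRuns (just (t′ , 1)) xs) (sym (+-identityʳ p))

record Realises (G : Graph) (C : CompactDecomposition) : Set where
  field
    iso   : Iso G (composeAll (G₀′ C) (comps′ C))
    chain : Chain (G₀′ C) (comps′ C)

realises-plain : ∀ {G₀ Ss its} → Classified Ss its → Admissible G₀ nothing its →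
  Realises (composeAll G₀ Ss) (record { G₀′ = G₀ ; comps′ = mergeRuns nothing its })
realises-plain {G₀} cl admissible = record
  { iso = mergeRuns-iso G₀ nothing cl ; chain = mergeRuns-chain G₀ nothing cl admissible }

-- G₀ starts a run together with the first components; it is treated as a pending run over
-- the empty graph.
realises-run : ∀ {G₀ S Ss t xs} → n G₀ ≡ 1 → SplitIso S (runComponent t 1) → Classified Ss xs →
  let (c , rest) = takeRun t xs in
  Realises (composeAll G₀ (S ∷ Ss))
    (record { G₀′ = graph (runComponent t (2 + c)) ; comps′ = mergeRuns nothing rest })
realises-run {G₀} {S} {Ss} {t} {xs} order1 S≅ cl = record
  { iso = Iso-trans (composeAll-cong Ss base≅)
            (Iso-trans merged (composeAll-cong (mergeRuns nothing rest) top≅))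
  ; chain = Chain-cong top≅ (tail (subst (Chain emptyGraph) split-off
              (mergeRuns-chain emptyGraph (just (t , 2)) cl (s≤s z≤n , s≤s (s≤s z≤n) , λ ()))))
  }
  where
  rest = proj₂ (takeRun t xs)
  top = runComponent t (2 + proj₁ (takeRun t xs))
  split-off : mergeRuns (just (t , 2)) xs ≡ top ∷ mergeRuns nothing rest
  split-off = mergeRuns-takeRun t 2 xs
  G₀≅ : Iso G₀ (runComponent t 1 ∘G emptyGraph)
  G₀≅ = Iso-trans (Iso-order1 order1 (runComponent-order t 1)) (∘G-identityʳ (runComponent t 1))
  base≅ : Iso (S ∘G G₀) (runComponent t 2 ∘G emptyGraph)
  base≅ = Iso-trans (∘G-cong S≅ G₀≅) (runComponent-merge t 1 emptyGraph)
  merged : Iso (composeAll (runComponent t 2 ∘G emptyGraph) Ss)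
               (composeAll (top ∘G emptyGraph) (mergeRuns nothing rest))
  merged = subst (Iso _ ∘ composeAll emptyGraph) split-off
             (mergeRuns-iso emptyGraph (just (t , 2)) cl)
  top≅ : Iso (top ∘G emptyGraph) (graph top)
  top≅ = Iso-sym (∘G-identityʳ top)
  tail : ∀ {B T Ts} → Chain B (T ∷ Ts) → Chain (T ∘G B) Ts
  tail (_ ∷ chain) = chain

compactFrom-realises : ∀ G₀ Ss → 1 ≤ n G₀ → Indecomposable G₀ → Classified Ss (map classify Ss) →
                       Realises (composeAll G₀ Ss) (compactFrom G₀ Ss)
compactFrom-realises G₀ Ss 1≤n indec cl with n G₀ in order | map classify Ss
... | suc (suc _) | its = realises-plain cl
  (admissible-nothing (≤-trans (s≤s z≤n) 2≤n)
     (NontrivialIndecomposable-noUniform (2≤n , indec)) its)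
  where
  2≤n : 2 ≤ n G₀
  2≤n = subst (2 ≤_) (sym order) (s≤s (s≤s z≤n))
... | suc zero | []         = realises-plain cl tt
... | suc zero | inj₂ _ ∷ _ = realises-plain cl tt
compactFrom-realises G₀ (S ∷ Ss) _ _ (single _ S≅ cl) | suc zero | inj₁ t ∷ xs =
  realises-run order S≅ cl
compactFrom-realises G₀ Ss () _ _ | zero | _

compact-realises : ∀ {G} (D : CanonicalDecomposition G) →
                   Realises (composeAll (G₀ D) (comps D)) (compact D)
compact-realises D = compactFrom-realises (G₀ D) (comps D) (G₀-nonempty D) (G₀-indec D)
  (classified (comps-nonempty D) (comps-indec D))

mainTheorem4 : (G : Graph) (D : CanonicalDecomposition G) →
    AutGroup G ≅ᴳ AutProduct (componentGraphs (compact D))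
mainTheorem4 G D = ≃ᴳ⇒≅ᴳ (≃ᴳ-trans (Aut-cong (iso D))
  (≃ᴳ-trans (Aut-cong (Realises.iso realisation)) (Aut-composeAll (Realises.chain realisation))))
  where
  realisation = compact-realises D
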